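{- Let $\gamma:=\prod_{j=1}^\infty(1-2^{ -j})$. For every integer $a\ge 1$ there is a sequence of examples, indexed by $m\to\infty$, consisting of an integer $n=n_m$ and a set $U=U_m\subseteq\mathbb F_2^{n}\setminus\{0\}$ of $2^m$ distinct nonzero vectors, such that for a uniformly random linear map $B:\mathbb F_2^{n}\to\mathbb F_2^m$, \[ \liminf_{m\to\infty}\Pr\left[|\{u\in U: Bu=0\}|>2^a-2\right]\ge \gamma^{ -1}2^{ -a^2}(1-2^{ -a})^2. \]
   Context: A uniformly random linear map is chosen uniformly among all $\mathbb F_2$-linear maps $\mathbb F_2^n\to\mathbb F_2^m$. -}

module Defs where

open import Data.Bool using (Bool; true; false; _xor_; _∧_)
open import Data.Nat using (ℕ; zero; suc; _^_; _∸_) renaming (_*_ to _*ℕ_)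
open import Data.Nat.Properties using (m^n≢0)
open import Data.Integer using (+_)
open import Data.Fin using (Fin)
open import Data.Vec using (Vec; replicate; foldr; zipWith; map) renaming ([] to []ᵛ; _∷_ to _∷ᵛ_)
open import Data.Vec.Properties using (≡-dec)
import Data.Bool.Properties as B
open import Data.List using (List; []; _∷_; length; filter; concatMap) renaming (map to mapL)
open import Data.List.Base using (allFin)
open import Data.Rational using (ℚ; _/_; _*_; _-_; 1ℚ)
open import Relation.Binary.PropositionalEquality using (_≡_)
open import Relation.Nullary using (Dec; ¬_)

-- F₂ is modelled by Bool, addition = xor, multiplication = ∧.
F2Vec : ℕ → Set
F2Vec n = Vec Bool n

zeroVec : ∀ n → F2Vec n
zeroVec n = replicate n false

_≟v_ : ∀ {n} (u v : F2Vec n) → Dec (u ≡ v)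
_≟v_ = ≡-dec B._≟_

dot : ∀ {n} → F2Vec n → F2Vec n → Bool
dot u v = foldr _ _xor_ false (zipWith _∧_ u v)

Matrix : ℕ → ℕ → Set
Matrix m n = Vec (F2Vec n) m

apply : ∀ {m n} → Matrix m n → F2Vec n → F2Vec m
apply B u = map (λ row → dot row u) B

allVecs : ∀ n → List (F2Vec n)
allVecs zero = []ᵛ ∷ []
allVecs (suc n) = concatMap (λ v → (false ∷ᵛ v) ∷ (true ∷ᵛ v) ∷ []) (allVecs n)

allMatrices : ∀ m n → List (Matrix m n)
allMatrices zero n = []ᵛ ∷ []
allMatrices (suc m) n =
  concatMap (λ B → mapL (λ r → r ∷ᵛ B) (allVecs n)) (allMatrices m n)

kernelCount : ∀ {m n k} → Matrix m n → (Fin k → F2Vec n) → ℕ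
kernelCount {m} {k = k} B U =
  length (filter (λ i → apply B (U i) ≟v zeroVec m) (allFin k))

goodCount : ∀ m n {k} → (Fin k → F2Vec n) → ℕ → ℕ
goodCount m n U t =
  length (filter (λ B → Data.Nat._≤?_ (suc t) (kernelCount B U)) (allMatrices m n))
  where import Data.Nat

-- Pr_B [ |{u ∈ U : Bu = 0}| > t ] for B uniform among all 2^(m*n) linear maps
prob : ∀ m n {k} → (Fin k → F2Vec n) → ℕ → ℚ
prob m n U t = _/_ (+ goodCount m n U t) (2 ^ (m *ℕ n)) {{m^n≢0 2 (m *ℕ n)}}

pow2inv : ℕ → ℚ
pow2inv k = _/_ (+ 1) (2 ^ k) {{m^n≢0 2 k}}

-- partial products of γ⁻¹ :  invγ N = ∏_{j=1}^{N} (1 - 2^{-j})⁻¹ = ∏_{j=1}^{N} 2^j / (2^j - 1).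
-- The denominator 2^j - 1 (j = suc N ≥ 1) is written as suc (2^j ∸ 2).
invγ : ℕ → ℚ
invγ zero = 1ℚ
invγ (suc N) = invγ N * (+ (2 ^ suc N) / suc (2 ^ suc N ∸ 2))

-- the bound  (∏_{j ≤ N} (1-2^{-j}))⁻¹ · 2^{-a²} · (1-2^{-a})², increasing in N with supremum
-- γ⁻¹ 2^{-a²} (1-2^{-a})²
bound : ℕ → ℕ → ℚ
bound a N = invγ N * pow2inv (a *ℕ a) * ((1ℚ - pow2inv a) * (1ℚ - pow2inv a))

module Submission where

-- Take n = m + 1 and let U consist of e₀ = (1, 0) and the vectors (0, x) with x ≠ 0. Writing
-- B = [c | B′] with B′ a uniform m × m matrix, every nonzero x ∈ ker B′ gives B (0, x) = 0, so B
-- annihilates at least |ker B′| - 1 = 2^a - 1 > 2^a - 2 vectors of U once rank B′ = m - a.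
-- Adding columns one at a time shows that there are [m choose L]₂ ∏_{i<L} (2^m - 2^i) matrices of
-- rank L, so for m = L + a
--   Pr[rank B′ = L] = 2^{-a²} ∏_{j=a+1}^{m} (1 - 2^{-j})² / ∏_{j=1}^{L} (1 - 2^{-j}).
-- The Weierstrass product inequality bounds the numerator below by (1 - 2^{-a})², and for L ≥ N
-- the denominator is at most the N-th partial product of γ.

open import Defs

module Counting where

  open import Algebra.Bundles using (CommutativeRing)
  open import Data.Bool using (Bool; true; false; _xor_; _∧_; if_then_else_)
  open import Data.Bool.Properties
    using (xor-comm; xor-assoc; xor-identityʳ; xor-same; ∧-zeroʳ; ∧-identityʳ; ∧-distribˡ-xor; xor-∧-commutativeRing)
  open import Data.Fin using (Fin; _↑ˡ_; _↑ʳ_; combine; remQuot; quotient; remainder)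
    renaming (zero to fzero; suc to fsuc)
  open import Data.Fin.Properties using (remQuot-combine; combine-remQuot)
  open import Data.List using (List; _++_; length; filter; concatMap; tabulate; allFin)
    renaming (_∷_ to _∷ˡ_; [] to []ˡ; map to mapˡ)
  open import Data.List.Properties using (map-++; map-tabulate; map-cong; map-∘)
  open import Data.Nat using (ℕ; zero; suc; _+_; _*_; _^_; _∸_; _≤_; z≤n; s≤s; NonZero; _≟_; _≤?_)
  open import Data.Nat.ListAction using (sum)
  open import Data.Nat.ListAction.Properties using (sum-++)
  open import Data.Nat.Properties
  open import Data.Nat.Tactic.RingSolver using (solve-∀)
  open import Data.Product using (∃; _,_; uncurry)
  open import Data.Sum using (inj₁; inj₂; [_,_])
  open import Data.Vec using ([]; _∷_; zipWith; head; tail)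
  import Data.Vec as Vec
  open import Data.Vec.Properties using (zipWith-assoc; zipWith-identityˡ; zipWith-identityʳ)
  open import Function using (_∘_; id; _⇔_; mk⇔)
  open import Function.Definitions using (Injective)
  open import Level using (0ℓ)
  open import Relation.Binary.PropositionalEquality
    using (_≡_; _≢_; refl; sym; trans; cong; cong₂; subst; module ≡-Reasoning)
  open import Relation.Nullary using (Dec; yes; no; does; ¬_; ¬?; map′; _⊎-dec_; contradiction)
  open import Relation.Nullary.Decidable using (does-⇔; dec-true; dec-false)
  open import Relation.Unary using (Pred; Decidable)
  open import Algebra.Properties.CommutativeSemigroup +-commutativeSemigroup
    using () renaming (interchange to +-interchange)
  open import Algebra.Properties.CommutativeSemigroup (CommutativeRing.+-commutativeSemigroup xor-∧-commutativeRing)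
    using () renaming (interchange to xor-interchange)

  infixl 6 _⊕_

  _⊕_ : ∀ {n} → F2Vec n → F2Vec n → F2Vec n
  _⊕_ = zipWith _xor_

  ⊕-assoc : ∀ {n} (x y z : F2Vec n) → (x ⊕ y) ⊕ z ≡ x ⊕ (y ⊕ z)
  ⊕-assoc = zipWith-assoc xor-assoc

  ⊕-identityˡ : ∀ {n} (x : F2Vec n) → zeroVec n ⊕ x ≡ x
  ⊕-identityˡ = zipWith-identityˡ (λ _ → refl)

  ⊕-identityʳ : ∀ {n} (x : F2Vec n) → x ⊕ zeroVec n ≡ x
  ⊕-identityʳ = zipWith-identityʳ xor-identityʳ

  ⊕-self : ∀ {n} (x : F2Vec n) → x ⊕ x ≡ zeroVec n
  ⊕-self []      = refl
  ⊕-self (b ∷ x) = cong₂ _∷_ (xor-same b) (⊕-self x)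

  ⊕≡0⇔≡ : ∀ {n} {x y : F2Vec n} → x ⊕ y ≡ zeroVec n ⇔ x ≡ y
  ⊕≡0⇔≡ {n} {x} {y} = mk⇔ x⊕y≡0⇒x≡y (λ { refl → ⊕-self x })
    where
    open ≡-Reasoning
    x⊕y≡0⇒x≡y : x ⊕ y ≡ zeroVec n → x ≡ y
    x⊕y≡0⇒x≡y x⊕y≡0 = begin
      x              ≡⟨ ⊕-identityʳ x ⟨
      x ⊕ zeroVec n  ≡⟨ cong (x ⊕_) (⊕-self y) ⟨
      x ⊕ (y ⊕ y)    ≡⟨ ⊕-assoc x y y ⟨
      (x ⊕ y) ⊕ y    ≡⟨ cong (_⊕ y) x⊕y≡0 ⟩
      zeroVec n ⊕ y  ≡⟨ ⊕-identityˡ y ⟩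
      y              ∎

  dot-⊕ : ∀ {n} (r x y : F2Vec n) → dot r (x ⊕ y) ≡ dot r x xor dot r y
  dot-⊕ []      []      []      = refl
  dot-⊕ (a ∷ r) (b ∷ x) (c ∷ y) = begin
    (a ∧ (b xor c)) xor dot r (x ⊕ y)                ≡⟨ cong₂ _xor_ (∧-distribˡ-xor a b c) (dot-⊕ r x y) ⟩
    ((a ∧ b) xor (a ∧ c)) xor (dot r x xor dot r y)  ≡⟨ xor-interchange (a ∧ b) (a ∧ c) (dot r x) (dot r y) ⟩
    ((a ∧ b) xor dot r x) xor ((a ∧ c) xor dot r y)  ∎
    where open ≡-Reasoning

  apply-⊕ : ∀ {m n} (B : Matrix m n) (x y : F2Vec n) → apply B (x ⊕ y) ≡ apply B x ⊕ apply B y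
  apply-⊕ []      x y = refl
  apply-⊕ (r ∷ B) x y = cong₂ _∷_ (dot-⊕ r x y) (apply-⊕ B x y)

  apply-[] : ∀ {m} (B : Matrix m 0) → apply B [] ≡ zeroVec m
  apply-[] []       = refl
  apply-[] ([] ∷ B) = cong (false ∷_) (apply-[] B)

  addCol : ∀ {m n} → F2Vec m → Matrix m n → Matrix m (suc n)
  addCol = zipWith _∷_

  headCol : ∀ {m n} → Matrix m (suc n) → F2Vec m
  headCol = Vec.map head

  tailCols : ∀ {m n} → Matrix m (suc n) → Matrix m n
  tailCols = Vec.map tail

  headCol-addCol : ∀ {m n} (c : F2Vec m) (B : Matrix m n) → headCol (addCol c B) ≡ c
  headCol-addCol []      []      = refl
  headCol-addCol (b ∷ c) (r ∷ B) = cong (b ∷_) (headCol-addCol c B)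

  tailCols-addCol : ∀ {m n} (c : F2Vec m) (B : Matrix m n) → tailCols (addCol c B) ≡ B
  tailCols-addCol []      []      = refl
  tailCols-addCol (b ∷ c) (r ∷ B) = cong (r ∷_) (tailCols-addCol c B)

  addCol-headCol-tailCols : ∀ {m n} (B : Matrix m (suc n)) → addCol (headCol B) (tailCols B) ≡ B
  addCol-headCol-tailCols []            = refl
  addCol-headCol-tailCols ((b ∷ r) ∷ B) = cong ((b ∷ r) ∷_) (addCol-headCol-tailCols B)

  apply-addCol-false : ∀ {m n} (c : F2Vec m) (B : Matrix m n) x → apply (addCol c B) (false ∷ x) ≡ apply B x
  apply-addCol-false []      []      x = refl
  apply-addCol-false (b ∷ c) (r ∷ B) x =
    cong₂ _∷_ (cong (_xor dot r x) (∧-zeroʳ b)) (apply-addCol-false c B x)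

  apply-addCol-true : ∀ {m n} (c : F2Vec m) (B : Matrix m n) x → apply (addCol c B) (true ∷ x) ≡ apply B x ⊕ c
  apply-addCol-true []      []      x = refl
  apply-addCol-true (b ∷ c) (r ∷ B) x =
    cong₂ _∷_ (trans (cong (_xor dot r x) (∧-identityʳ b)) (xor-comm b (dot r x))) (apply-addCol-true c B x)

  𝟙 : ∀ {a} {A : Set a} → Dec A → ℕ
  𝟙 A? = if does A? then 1 else 0

  𝟙-yes : ∀ {a} {A : Set a} (A? : Dec A) → A → 𝟙 A? ≡ 1
  𝟙-yes A? x = cong (if_then 1 else 0) (dec-true A? x)

  𝟙-no : ∀ {a} {A : Set a} (A? : Dec A) → ¬ A → 𝟙 A? ≡ 0
  𝟙-no A? ¬x = cong (if_then 1 else 0) (dec-false A? ¬x)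

  𝟙≤1 : ∀ {a} {A : Set a} (A? : Dec A) → 𝟙 A? ≤ 1
  𝟙≤1 (yes _) = s≤s z≤n
  𝟙≤1 (no _)  = z≤n

  𝟙-⇔ : ∀ {a b} {A : Set a} {B : Set b} → A ⇔ B → (A? : Dec A) (B? : Dec B) → 𝟙 A? ≡ 𝟙 B?
  𝟙-⇔ A⇔B A? B? = cong (if_then 1 else 0) (does-⇔ A⇔B A? B?)

  𝟙-mono : ∀ {a b} {A : Set a} {B : Set b} (A? : Dec A) (B? : Dec B) → (A → B) → 𝟙 A? ≤ 𝟙 B?
  𝟙-mono (yes _) (yes _) _   = s≤s z≤n
  𝟙-mono (yes x) (no ¬y) A→B = contradiction (A→B x) ¬y
  𝟙-mono (no _)  _       _   = z≤n

  𝟙≡-subst : ∀ (f : ℕ → ℕ) {i j} (i≟j : Dec (i ≡ j)) → 𝟙 i≟j * f i ≡ 𝟙 i≟j * f j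
  𝟙≡-subst f (yes refl) = refl
  𝟙≡-subst f (no _)     = refl

  sumF2 : ∀ n → (F2Vec n → ℕ) → ℕ
  sumF2 zero    f = f []
  sumF2 (suc n) f = sumF2 n (f ∘ (false ∷_)) + sumF2 n (f ∘ (true ∷_))

  sumF2-cong : ∀ n {f g : F2Vec n → ℕ} → (∀ x → f x ≡ g x) → sumF2 n f ≡ sumF2 n g
  sumF2-cong zero    f≗g = f≗g []
  sumF2-cong (suc n) f≗g = cong₂ _+_ (sumF2-cong n (f≗g ∘ (false ∷_))) (sumF2-cong n (f≗g ∘ (true ∷_)))

  sumF2-mono : ∀ n {f g : F2Vec n → ℕ} → (∀ x → f x ≤ g x) → sumF2 n f ≤ sumF2 n g
  sumF2-mono zero    f≤g = f≤g []
  sumF2-mono (suc n) f≤g = +-mono-≤ (sumF2-mono n (f≤g ∘ (false ∷_))) (sumF2-mono n (f≤g ∘ (true ∷_)))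

  sumF2-+ : ∀ n (f g : F2Vec n → ℕ) → sumF2 n (λ x → f x + g x) ≡ sumF2 n f + sumF2 n g
  sumF2-+ zero    f g = refl
  sumF2-+ (suc n) f g =
    trans (cong₂ _+_ (sumF2-+ n (f ∘ (false ∷_)) (g ∘ (false ∷_))) (sumF2-+ n (f ∘ (true ∷_)) (g ∘ (true ∷_))))
          (+-interchange (sumF2 n (f ∘ (false ∷_))) _ _ _)

  sumF2-* : ∀ n k (f : F2Vec n → ℕ) → sumF2 n (λ x → k * f x) ≡ k * sumF2 n f
  sumF2-* zero    k f = refl
  sumF2-* (suc n) k f =
    trans (cong₂ _+_ (sumF2-* n k (f ∘ (false ∷_))) (sumF2-* n k (f ∘ (true ∷_)))) (sym (*-distribˡ-+ k _ _))

  sumF2-const : ∀ n k → sumF2 n (λ _ → k) ≡ 2 ^ n * k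
  sumF2-const zero    k = sym (*-identityˡ k)
  sumF2-const (suc n) k = begin
    sumF2 n (λ _ → k) + sumF2 n (λ _ → k)  ≡⟨ cong₂ _+_ (sumF2-const n k) (sumF2-const n k) ⟩
    2 ^ n * k + 2 ^ n * k                  ≡⟨ *-distribʳ-+ k (2 ^ n) (2 ^ n) ⟨
    (2 ^ n + 2 ^ n) * k                    ≡⟨ cong (λ x → (2 ^ n + x) * k) (+-identityʳ (2 ^ n)) ⟨
    2 ^ suc n * k                          ∎
    where open ≡-Reasoning

  sumF2-zero : ∀ n → sumF2 n (λ _ → 0) ≡ 0
  sumF2-zero n = trans (sumF2-const n 0) (*-zeroʳ (2 ^ n))

  sumF2-comm : ∀ n k (f : F2Vec n → F2Vec k → ℕ) →
    sumF2 n (λ x → sumF2 k (f x)) ≡ sumF2 k (λ y → sumF2 n (λ x → f x y))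
  sumF2-comm zero    k f = refl
  sumF2-comm (suc n) k f =
    trans (cong₂ _+_ (sumF2-comm n k (f ∘ (false ∷_))) (sumF2-comm n k (f ∘ (true ∷_)))) (sym (sumF2-+ k _ _))

  sumF2-⊕ : ∀ n (f : F2Vec n → ℕ) c → sumF2 n (λ x → f (x ⊕ c)) ≡ sumF2 n f
  sumF2-⊕ zero    f []          = refl
  sumF2-⊕ (suc n) f (false ∷ c) =
    cong₂ _+_ (sumF2-⊕ n (f ∘ (false ∷_)) c) (sumF2-⊕ n (f ∘ (true ∷_)) c)
  sumF2-⊕ (suc n) f (true ∷ c)  =
    trans (cong₂ _+_ (sumF2-⊕ n (f ∘ (true ∷_)) c) (sumF2-⊕ n (f ∘ (false ∷_)) c))
          (+-comm (sumF2 n (f ∘ (true ∷_))) _)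

  sumF2-𝟙≟ : ∀ n (v : F2Vec n) → sumF2 n (λ x → 𝟙 (v ≟v x)) ≡ 1
  sumF2-𝟙≟ zero    []          = refl
  sumF2-𝟙≟ (suc n) (false ∷ v) = cong₂ _+_ (sumF2-𝟙≟ n v) (sumF2-zero n)
  sumF2-𝟙≟ (suc n) (true ∷ v)  = cong₂ _+_ (sumF2-zero n) (sumF2-𝟙≟ n v)

  count : ∀ n {p} {P : Pred (F2Vec n) p} → Decidable P → ℕ
  count n P? = sumF2 n (𝟙 ∘ P?)

  count-¬ : ∀ n {p} {P : Pred (F2Vec n) p} (P? : Decidable P) → count n (¬? ∘ P?) ≡ 2 ^ n ∸ count n P?
  count-¬ n P? = begin
    count n (¬? ∘ P?)
      ≡⟨ m+n∸m≡n (count n P?) _ ⟨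
    count n P? + count n (¬? ∘ P?) ∸ count n P?
      ≡⟨ cong (_∸ count n P?) (sumF2-+ n _ _) ⟨
    sumF2 n (λ x → 𝟙 (P? x) + 𝟙 (¬? (P? x))) ∸ count n P?
      ≡⟨ cong (_∸ count n P?) (sumF2-cong n (𝟙+𝟙¬≡1 ∘ P?)) ⟩
    sumF2 n (λ _ → 1) ∸ count n P?
      ≡⟨ cong (_∸ count n P?) (trans (sumF2-const n 1) (*-identityʳ _)) ⟩
    2 ^ n ∸ count n P? ∎
    where
    open ≡-Reasoning
    𝟙+𝟙¬≡1 : ∀ {q} {Q : Set q} (Q? : Dec Q) → 𝟙 Q? + 𝟙 (¬? Q?) ≡ 1
    𝟙+𝟙¬≡1 (yes _) = refl
    𝟙+𝟙¬≡1 (no _)  = refl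

  sumMat : ∀ m n → (Matrix m n → ℕ) → ℕ
  sumMat zero    n f = f []
  sumMat (suc m) n f = sumMat m n (λ B → sumF2 n (λ r → f (r ∷ B)))

  sumMat-cong : ∀ m n {f g : Matrix m n → ℕ} → (∀ B → f B ≡ g B) → sumMat m n f ≡ sumMat m n g
  sumMat-cong zero    n f≗g = f≗g []
  sumMat-cong (suc m) n f≗g = sumMat-cong m n (λ B → sumF2-cong n (λ r → f≗g (r ∷ B)))

  sumMat-mono : ∀ m n {f g : Matrix m n → ℕ} → (∀ B → f B ≤ g B) → sumMat m n f ≤ sumMat m n g
  sumMat-mono zero    n f≤g = f≤g []
  sumMat-mono (suc m) n f≤g = sumMat-mono m n (λ B → sumF2-mono n (λ r → f≤g (r ∷ B)))

  sumMat-+ : ∀ m n (f g : Matrix m n → ℕ) → sumMat m n (λ B → f B + g B) ≡ sumMat m n f + sumMat m n g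
  sumMat-+ zero    n f g = refl
  sumMat-+ (suc m) n f g = trans (sumMat-cong m n (λ B → sumF2-+ n _ _)) (sumMat-+ m n _ _)

  sumMat-* : ∀ m n k (f : Matrix m n → ℕ) → sumMat m n (λ B → k * f B) ≡ k * sumMat m n f
  sumMat-* zero    n k f = refl
  sumMat-* (suc m) n k f = trans (sumMat-cong m n (λ B → sumF2-* n k _)) (sumMat-* m n k _)

  sumMat-noCols : ∀ m k → sumMat m 0 (λ _ → k) ≡ k
  sumMat-noCols zero    k = refl
  sumMat-noCols (suc m) k = sumMat-noCols m k

  sumF2-sumMat-comm : ∀ k m n (f : F2Vec k → Matrix m n → ℕ) →
    sumF2 k (λ c → sumMat m n (f c)) ≡ sumMat m n (λ B → sumF2 k (λ c → f c B))
  sumF2-sumMat-comm k zero    n f = refl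
  sumF2-sumMat-comm k (suc m) n f =
    trans (sumF2-sumMat-comm k m n _) (sumMat-cong m n (λ B → sumF2-comm k n _))

  sumMat-addCol : ∀ m n (f : Matrix m (suc n) → ℕ) →
    sumMat m (suc n) f ≡ sumF2 m (λ c → sumMat m n (f ∘ addCol c))
  sumMat-addCol zero    n f = refl
  sumMat-addCol (suc m) n f =
    trans (sumMat-+ m (suc n) (λ B → sumF2 n (λ r → f ((false ∷ r) ∷ B))) (λ B → sumF2 n (λ r → f ((true ∷ r) ∷ B))))
          (cong₂ _+_ (sumMat-addCol m n _) (sumMat-addCol m n _))

  sumFin : ∀ n → (Fin n → ℕ) → ℕ
  sumFin zero    f = 0
  sumFin (suc n) f = f fzero + sumFin n (f ∘ fsuc)

  sumFin-cong : ∀ n {f g : Fin n → ℕ} → (∀ i → f i ≡ g i) → sumFin n f ≡ sumFin n g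
  sumFin-cong zero    f≗g = refl
  sumFin-cong (suc n) f≗g = cong₂ _+_ (f≗g fzero) (sumFin-cong n (f≗g ∘ fsuc))

  sumFin-↑ : ∀ k l (f : Fin (k + l) → ℕ) → sumFin (k + l) f ≡ sumFin k (f ∘ (_↑ˡ l)) + sumFin l (f ∘ (k ↑ʳ_))
  sumFin-↑ zero    l f = refl
  sumFin-↑ (suc k) l f = trans (cong (f fzero +_) (sumFin-↑ k l (f ∘ fsuc))) (sym (+-assoc (f fzero) _ _))

  sumFin-combine : ∀ n k (f : Fin (n * k) → ℕ) → sumFin (n * k) f ≡ sumFin n (λ q → sumFin k (f ∘ combine q))
  sumFin-combine zero    k f = refl
  sumFin-combine (suc n) k f =
    trans (sumFin-↑ k (n * k) f) (cong (sumFin k (f ∘ (_↑ˡ n * k)) +_) (sumFin-combine n k (f ∘ (k ↑ʳ_))))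

  bit : Fin 2 → Bool
  bit fzero        = false
  bit (fsuc fzero) = true

  bit-injective : ∀ {q q′} → bit q ≡ bit q′ → q ≡ q′
  bit-injective {fzero}      {fzero}      _ = refl
  bit-injective {fsuc fzero} {fsuc fzero} _ = refl
  bit-injective {fzero}      {fsuc fzero} ()
  bit-injective {fsuc fzero} {fzero}      ()

  bits : ∀ m → Fin (2 ^ m) → F2Vec m
  bits zero    _ = []
  bits (suc m) i = bit (quotient (2 ^ m) i) ∷ bits m (remainder {2} (2 ^ m) i)

  bits-combine : ∀ m q r → bits (suc m) (combine q r) ≡ bit q ∷ bits m r
  bits-combine m q r = cong (λ (q , r) → bit q ∷ bits m r) (remQuot-combine q r)

  bits-injective : ∀ m {i j} → bits m i ≡ bits m j → i ≡ j
  bits-injective zero    {fzero} {fzero} _ = refl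
  bits-injective (suc m) {i} {j} bi≡bj = begin
    i                                    ≡⟨ combine-remQuot {2} (2 ^ m) i ⟨
    uncurry combine (remQuot (2 ^ m) i)  ≡⟨ cong₂ combine (bit-injective (cong head bi≡bj))
                                                          (bits-injective m (cong tail bi≡bj)) ⟩
    uncurry combine (remQuot (2 ^ m) j)  ≡⟨ combine-remQuot {2} (2 ^ m) j ⟩
    j                                    ∎
    where open ≡-Reasoning

  sumFin-bits : ∀ m (f : F2Vec m → ℕ) → sumFin (2 ^ m) (f ∘ bits m) ≡ sumF2 m f
  sumFin-bits zero    f = +-identityʳ (f [])
  sumFin-bits (suc m) f = begin
    sumFin (2 * 2 ^ m) (f ∘ bits (suc m))
      ≡⟨ sumFin-combine 2 (2 ^ m) _ ⟩
    sumFin 2 (λ q → sumFin (2 ^ m) (f ∘ bits (suc m) ∘ combine q))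
      ≡⟨ sumFin-cong 2 (λ q → sumFin-cong (2 ^ m) (cong f ∘ bits-combine m q)) ⟩
    sumFin (2 ^ m) (f ∘ (false ∷_) ∘ bits m) + (sumFin (2 ^ m) (f ∘ (true ∷_) ∘ bits m) + 0)
      ≡⟨ cong₂ _+_ (sumFin-bits m _) (trans (+-identityʳ _) (sumFin-bits m _)) ⟩
    sumF2 (suc m) f ∎
    where open ≡-Reasoning

  length-filter≡sum-𝟙 : ∀ {A : Set} {p} {P : Pred A p} (P? : Decidable P) xs →
    length (filter P? xs) ≡ sum (mapˡ (𝟙 ∘ P?) xs)
  length-filter≡sum-𝟙 P? []ˡ       = refl
  length-filter≡sum-𝟙 P? (x ∷ˡ xs) with does (P? x)
  ... | true  = cong suc (length-filter≡sum-𝟙 P? xs)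
  ... | false = length-filter≡sum-𝟙 P? xs

  sum-map-concatMap : ∀ {A B : Set} (f : B → ℕ) (g : A → List B) xs →
    sum (mapˡ f (concatMap g xs)) ≡ sum (mapˡ (λ x → sum (mapˡ f (g x))) xs)
  sum-map-concatMap f g []ˡ       = refl
  sum-map-concatMap f g (x ∷ˡ xs) = begin
    sum (mapˡ f (g x ++ concatMap g xs))                 ≡⟨ cong sum (map-++ f (g x) _) ⟩
    sum (mapˡ f (g x) ++ mapˡ f (concatMap g xs))        ≡⟨ sum-++ (mapˡ f (g x)) _ ⟩
    sum (mapˡ f (g x)) + sum (mapˡ f (concatMap g xs))   ≡⟨ cong (sum (mapˡ f (g x)) +_) (sum-map-concatMap f g xs) ⟩
    sum (mapˡ (λ x → sum (mapˡ f (g x))) (x ∷ˡ xs))      ∎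
    where open ≡-Reasoning

  sum-allFin : ∀ n (f : Fin n → ℕ) → sum (mapˡ f (allFin n)) ≡ sumFin n f
  sum-allFin n f = trans (cong sum (map-tabulate id f)) (sum-tabulate n f)
    where
    sum-tabulate : ∀ n (f : Fin n → ℕ) → sum (tabulate f) ≡ sumFin n f
    sum-tabulate zero    f = refl
    sum-tabulate (suc n) f = cong (f fzero +_) (sum-tabulate n (f ∘ fsuc))

  sum-allVecs : ∀ n (f : F2Vec n → ℕ) → sum (mapˡ f (allVecs n)) ≡ sumF2 n f
  sum-allVecs zero    f = +-identityʳ (f [])
  sum-allVecs (suc n) f = begin
    sum (mapˡ f (allVecs (suc n)))
      ≡⟨ sum-map-concatMap f _ (allVecs n) ⟩
    sum (mapˡ (λ v → f (false ∷ v) + (f (true ∷ v) + 0)) (allVecs n))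
      ≡⟨ sum-allVecs n _ ⟩
    sumF2 n (λ v → f (false ∷ v) + (f (true ∷ v) + 0))
      ≡⟨ sumF2-cong n (λ v → cong (f (false ∷ v) +_) (+-identityʳ _)) ⟩
    sumF2 n (λ v → f (false ∷ v) + f (true ∷ v))
      ≡⟨ sumF2-+ n _ _ ⟩
    sumF2 (suc n) f ∎
    where open ≡-Reasoning

  sum-allMatrices : ∀ m n (f : Matrix m n → ℕ) → sum (mapˡ f (allMatrices m n)) ≡ sumMat m n f
  sum-allMatrices zero    n f = +-identityʳ (f [])
  sum-allMatrices (suc m) n f = begin
    sum (mapˡ f (allMatrices (suc m) n))
      ≡⟨ sum-map-concatMap f _ (allMatrices m n) ⟩
    sum (mapˡ (λ B → sum (mapˡ f (mapˡ (_∷ B) (allVecs n)))) (allMatrices m n))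
      ≡⟨ cong sum (map-cong (λ B → trans (cong sum (sym (map-∘ (allVecs n)))) (sum-allVecs n _)) (allMatrices m n)) ⟩
    sum (mapˡ (λ B → sumF2 n (λ r → f (r ∷ B))) (allMatrices m n))
      ≡⟨ sum-allMatrices m n _ ⟩
    sumMat (suc m) n f ∎
    where open ≡-Reasoning

  ∃? : ∀ n {p} {P : Pred (F2Vec n) p} → Decidable P → Dec (∃ P)
  ∃? zero    P? = map′ ([] ,_) (λ { ([] , p) → p }) (P? [])
  ∃? (suc n) P? = map′ [ (λ (x , p) → false ∷ x , p) , (λ (x , p) → true ∷ x , p) ]
                       (λ { (false ∷ x , p) → inj₁ (x , p) ; (true ∷ x , p) → inj₂ (x , p) })
                       (∃? n (P? ∘ (false ∷_)) ⊎-dec ∃? n (P? ∘ (true ∷_)))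

  module _ {m n : ℕ} (B : Matrix m n) where

    Image : Pred (F2Vec m) 0ℓ
    Image y = ∃ λ x → apply B x ≡ y

    image? : Decidable Image
    image? y = ∃? n (λ x → apply B x ≟v y)

    kernelSize : ℕ
    kernelSize = count n (λ x → apply B x ≟v zeroVec m)

    fiberSize : F2Vec m → ℕ
    fiberSize y = count n (λ x → apply B x ≟v y)

    imageSize : ℕ
    imageSize = count m image?

    fiberSize-image : ∀ {y} → Image y → fiberSize y ≡ kernelSize
    fiberSize-image {y} (x₀ , Bx₀≡y) = sym (begin
      sumF2 n (λ x → 𝟙 (apply B x ≟v zeroVec m))
        ≡⟨ sumF2-⊕ n _ x₀ ⟨
      sumF2 n (λ x → 𝟙 (apply B (x ⊕ x₀) ≟v zeroVec m))
        ≡⟨ sumF2-cong n (λ x → 𝟙-⇔ (translate x) (apply B (x ⊕ x₀) ≟v zeroVec m) (apply B x ≟v y)) ⟩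
      sumF2 n (λ x → 𝟙 (apply B x ≟v y)) ∎)
      where
      open ≡-Reasoning
      translate : ∀ x → apply B (x ⊕ x₀) ≡ zeroVec m ⇔ apply B x ≡ y
      translate x = subst (λ v → v ≡ zeroVec m ⇔ apply B x ≡ y)
                          (sym (trans (apply-⊕ B x x₀) (cong (apply B x ⊕_) Bx₀≡y))) ⊕≡0⇔≡

    fiberSize-∉image : ∀ {y} → ¬ Image y → fiberSize y ≡ 0
    fiberSize-∉image {y} y∉ =
      trans (sumF2-cong n (λ x → 𝟙-no (apply B x ≟v y) (y∉ ∘ (x ,_)))) (sumF2-zero n)

    fiberSize≡kernelSize*𝟙 : ∀ y → fiberSize y ≡ kernelSize * 𝟙 (image? y)
    fiberSize≡kernelSize*𝟙 y with image? y
    ... | yes y∈ = trans (fiberSize-image y∈) (sym (*-identityʳ kernelSize))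
    ... | no  y∉ = trans (fiberSize-∉image y∉) (sym (*-zeroʳ kernelSize))

    sumF2-fiberSize : sumF2 m fiberSize ≡ 2 ^ n
    sumF2-fiberSize = begin
      sumF2 m (λ y → sumF2 n (λ x → 𝟙 (apply B x ≟v y)))  ≡⟨ sumF2-comm m n _ ⟩
      sumF2 n (λ x → sumF2 m (λ y → 𝟙 (apply B x ≟v y)))  ≡⟨ sumF2-cong n (λ x → sumF2-𝟙≟ m (apply B x)) ⟩
      sumF2 n (λ _ → 1)                                   ≡⟨ sumF2-const n 1 ⟩
      2 ^ n * 1                                           ≡⟨ *-identityʳ (2 ^ n) ⟩
      2 ^ n                                               ∎
      where open ≡-Reasoning

    kernelSize*imageSize : kernelSize * imageSize ≡ 2 ^ n
    kernelSize*imageSize = begin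
      kernelSize * imageSize                     ≡⟨ sumF2-* m kernelSize _ ⟨
      sumF2 m (λ y → kernelSize * 𝟙 (image? y))  ≡⟨ sumF2-cong m fiberSize≡kernelSize*𝟙 ⟨
      sumF2 m fiberSize                          ≡⟨ sumF2-fiberSize ⟩
      2 ^ n                                      ∎
      where open ≡-Reasoning

  kernelSize-addCol : ∀ {m n} (c : F2Vec m) (B : Matrix m n) →
    kernelSize (addCol c B) ≡ kernelSize B + fiberSize B c
  kernelSize-addCol {m} {n} c B = cong₂ _+_
    (sumF2-cong n (λ x → cong (λ v → 𝟙 (v ≟v zeroVec m)) (apply-addCol-false c B x)))
    (sumF2-cong n (λ x → trans (cong (λ v → 𝟙 (v ≟v zeroVec m)) (apply-addCol-true c B x))
                               (𝟙-⇔ ⊕≡0⇔≡ ((apply B x ⊕ c) ≟v zeroVec m) (apply B x ≟v c))))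

  rank : ∀ {m} n → Matrix m n → ℕ
  rank zero    B = 0
  rank (suc n) B = 𝟙 (¬? (image? (tailCols B) (headCol B))) + rank n (tailCols B)

  rank-addCol : ∀ {m n} (c : F2Vec m) (B : Matrix m n) → rank (suc n) (addCol c B) ≡ 𝟙 (¬? (image? B c)) + rank n B
  rank-addCol {n = n} c B =
    cong₂ (λ c′ B′ → 𝟙 (¬? (image? B′ c′)) + rank n B′) (headCol-addCol c B) (tailCols-addCol c B)

  kernelSize*2^rank : ∀ {m} n (B : Matrix m n) → kernelSize B * 2 ^ rank n B ≡ 2 ^ n
  kernelSize*2^rank {m} zero B =
    trans (cong (λ v → 𝟙 (v ≟v zeroVec m) * 1) (apply-[] B)) (cong (_* 1) (𝟙-yes (zeroVec m ≟v zeroVec m) refl))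
  kernelSize*2^rank (suc n) B =
    subst (λ B → kernelSize B * 2 ^ rank (suc n) B ≡ 2 ^ suc n) (addCol-headCol-tailCols B)
          (kernelSize*2^rank-addCol (headCol B) (tailCols B))
    where
    doubling : ∀ {a} {A : Set a} (A? : Dec A) k ρ → (k + k * 𝟙 A?) * 2 ^ (𝟙 (¬? A?) + ρ) ≡ 2 * (k * 2 ^ ρ)
    doubling (yes _) k ρ = identity k (2 ^ ρ)
      where identity : ∀ k p → (k + k * 1) * p ≡ 2 * (k * p)
            identity = solve-∀
    doubling (no _)  k ρ = identity k (2 ^ ρ)
      where identity : ∀ k p → (k + k * 0) * (2 * p) ≡ 2 * (k * p)
            identity = solve-∀
    kernelSize*2^rank-addCol : ∀ c B′ → kernelSize (addCol c B′) * 2 ^ rank (suc n) (addCol c B′) ≡ 2 ^ suc n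
    kernelSize*2^rank-addCol c B′ = begin
      kernelSize (addCol c B′) * 2 ^ rank (suc n) (addCol c B′)
        ≡⟨ cong₂ (λ k ρ → k * 2 ^ ρ)
                 (trans (kernelSize-addCol c B′) (cong (kernelSize B′ +_) (fiberSize≡kernelSize*𝟙 B′ c)))
                 (rank-addCol c B′) ⟩
      (kernelSize B′ + kernelSize B′ * 𝟙 (image? B′ c)) * 2 ^ (𝟙 (¬? (image? B′ c)) + rank n B′)
        ≡⟨ doubling (image? B′ c) (kernelSize B′) (rank n B′) ⟩
      2 * (kernelSize B′ * 2 ^ rank n B′)
        ≡⟨ cong (2 *_) (kernelSize*2^rank n B′) ⟩
      2 ^ suc n ∎
      where open ≡-Reasoning

  imageSize≡2^rank : ∀ {m} n (B : Matrix m n) → imageSize B ≡ 2 ^ rank n B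
  imageSize≡2^rank n B = *-cancelˡ-≡ (imageSize B) (2 ^ rank n B) (kernelSize B) {{kernelSize≢0}}
    (trans (kernelSize*imageSize B) (sym (kernelSize*2^rank n B)))
    where
    kernelSize≢0 : NonZero (kernelSize B)
    kernelSize≢0 = m*n≢0⇒m≢0 (kernelSize B) {{subst NonZero (sym (kernelSize*2^rank n B)) (m^n≢0 2 n)}}

  kernelSize-of-rank : ∀ {m} n (B : Matrix m n) {k} → rank n B + k ≡ n → kernelSize B ≡ 2 ^ k
  kernelSize-of-rank n B {k} ρ+k≡n = *-cancelʳ-≡ (kernelSize B) (2 ^ k) (2 ^ rank n B) {{m^n≢0 2 (rank n B)}} (begin
    kernelSize B * 2 ^ rank n B  ≡⟨ kernelSize*2^rank n B ⟩
    2 ^ n                        ≡⟨ cong (2 ^_) ρ+k≡n ⟨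
    2 ^ (rank n B + k)           ≡⟨ ^-distribˡ-+-* 2 (rank n B) k ⟩
    2 ^ rank n B * 2 ^ k         ≡⟨ *-comm (2 ^ rank n B) (2 ^ k) ⟩
    2 ^ k * 2 ^ rank n B         ∎)
    where open ≡-Reasoning

  gaussBinom : ℕ → ℕ → ℕ
  gaussBinom zero    zero    = 1
  gaussBinom zero    (suc k) = 0
  gaussBinom (suc n) zero    = 1
  gaussBinom (suc n) (suc k) = gaussBinom n k + 2 ^ suc k * gaussBinom n (suc k)

  gaussBinom-zero : ∀ n → gaussBinom n 0 ≡ 1
  gaussBinom-zero zero    = refl
  gaussBinom-zero (suc n) = refl

  indepTuples : ℕ → ℕ → ℕ
  indepTuples m zero    = 1
  indepTuples m (suc r) = indepTuples m r * (2 ^ m ∸ 2 ^ r)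

  rankCount : ℕ → ℕ → ℕ → ℕ
  rankCount m n r = sumMat m n (λ B → 𝟙 (rank n B ≟ r))

  sumF2-𝟙rank-addCol : ∀ {m n} (B : Matrix m n) r →
    sumF2 m (λ c → 𝟙 (rank (suc n) (addCol c B) ≟ r))
      ≡ 𝟙 (rank n B ≟ r) * 2 ^ rank n B + 𝟙 (suc (rank n B) ≟ r) * (2 ^ m ∸ 2 ^ rank n B)
  sumF2-𝟙rank-addCol {m} {n} B r = begin
    sumF2 m (λ c → 𝟙 (rank (suc n) (addCol c B) ≟ r))
      ≡⟨ sumF2-cong m (λ c → trans (cong (λ ρ → 𝟙 (ρ ≟ r)) (rank-addCol c B)) (split (image? B c))) ⟩
    sumF2 m (λ c → 𝟙 (ρ ≟ r) * 𝟙 (image? B c) + 𝟙 (suc ρ ≟ r) * 𝟙 (¬? (image? B c)))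
      ≡⟨ trans (sumF2-+ m (λ c → 𝟙 (ρ ≟ r) * 𝟙 (image? B c)) (λ c → 𝟙 (suc ρ ≟ r) * 𝟙 (¬? (image? B c))))
               (cong₂ _+_ (sumF2-* m (𝟙 (ρ ≟ r)) (𝟙 ∘ image? B))
                          (sumF2-* m (𝟙 (suc ρ ≟ r)) (𝟙 ∘ ¬? ∘ image? B))) ⟩
    𝟙 (ρ ≟ r) * imageSize B + 𝟙 (suc ρ ≟ r) * count m (¬? ∘ image? B)
      ≡⟨ cong₂ (λ i j → 𝟙 (ρ ≟ r) * i + 𝟙 (suc ρ ≟ r) * j)
               (imageSize≡2^rank n B) (trans (count-¬ m (image? B)) (cong (2 ^ m ∸_) (imageSize≡2^rank n B))) ⟩
    𝟙 (ρ ≟ r) * 2 ^ ρ + 𝟙 (suc ρ ≟ r) * (2 ^ m ∸ 2 ^ ρ) ∎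
    where
    open ≡-Reasoning
    ρ = rank n B
    split : ∀ {a} {A : Set a} (A? : Dec A) →
      𝟙 (𝟙 (¬? A?) + ρ ≟ r) ≡ 𝟙 (ρ ≟ r) * 𝟙 A? + 𝟙 (suc ρ ≟ r) * 𝟙 (¬? A?)
    split (yes _) =
      sym (trans (cong₂ _+_ (*-identityʳ (𝟙 (ρ ≟ r))) (*-zeroʳ (𝟙 (suc ρ ≟ r)))) (+-identityʳ (𝟙 (ρ ≟ r))))
    split (no _)  = sym (cong₂ _+_ (*-zeroʳ (𝟙 (ρ ≟ r))) (*-identityʳ (𝟙 (suc ρ ≟ r))))

  rankCount-addCol : ∀ m n r → rankCount m (suc n) r ≡
    sumMat m n (λ B → 𝟙 (rank n B ≟ r) * 2 ^ rank n B + 𝟙 (suc (rank n B) ≟ r) * (2 ^ m ∸ 2 ^ rank n B))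
  rankCount-addCol m n r =
    trans (sumMat-addCol m n _) (trans (sumF2-sumMat-comm m m n _) (sumMat-cong m n (λ B → sumF2-𝟙rank-addCol B r)))

  rankCount≡gaussBinom*indepTuples : ∀ m n r → rankCount m n r ≡ gaussBinom n r * indepTuples m r
  rankCount≡gaussBinom*indepTuples m zero    zero    = sumMat-noCols m 1
  rankCount≡gaussBinom*indepTuples m zero    (suc r) = sumMat-noCols m 0
  rankCount≡gaussBinom*indepTuples m (suc n) zero    = begin
    rankCount m (suc n) 0
      ≡⟨ rankCount-addCol m n 0 ⟩
    sumMat m n (λ B → 𝟙 (rank n B ≟ 0) * 2 ^ rank n B + 0 * (2 ^ m ∸ 2 ^ rank n B))
      ≡⟨ sumMat-cong m n (λ B → trans (+-identityʳ _) (trans (𝟙≡-subst (2 ^_) (rank n B ≟ 0)) (*-identityʳ _))) ⟩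
    rankCount m n 0
      ≡⟨ rankCount≡gaussBinom*indepTuples m n 0 ⟩
    gaussBinom n 0 * 1
      ≡⟨ cong (_* 1) (gaussBinom-zero n) ⟩
    1 * 1 ∎
    where open ≡-Reasoning
  rankCount≡gaussBinom*indepTuples m (suc n) (suc r) = begin
    rankCount m (suc n) (suc r)
      ≡⟨ rankCount-addCol m n (suc r) ⟩
    sumMat m n (λ B → 𝟙 (rank n B ≟ suc r) * 2 ^ rank n B + 𝟙 (rank n B ≟ r) * (2 ^ m ∸ 2 ^ rank n B))
      ≡⟨ sumMat-cong m n (λ B → cong₂ _+_ (𝟙≡-subst (2 ^_) (rank n B ≟ suc r))
                                          (𝟙≡-subst (λ ρ → 2 ^ m ∸ 2 ^ ρ) (rank n B ≟ r))) ⟩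
    sumMat m n (λ B → 𝟙 (rank n B ≟ suc r) * 2 ^ suc r + 𝟙 (rank n B ≟ r) * (2 ^ m ∸ 2 ^ r))
      ≡⟨ trans (sumMat-+ m n (λ B → 𝟙 (rank n B ≟ suc r) * 2 ^ suc r) (λ B → 𝟙 (rank n B ≟ r) * (2 ^ m ∸ 2 ^ r)))
               (cong₂ _+_ (scale (2 ^ suc r) (suc r)) (scale (2 ^ m ∸ 2 ^ r) r)) ⟩
    2 ^ suc r * rankCount m n (suc r) + (2 ^ m ∸ 2 ^ r) * rankCount m n r
      ≡⟨ cong₂ (λ x y → 2 ^ suc r * x + (2 ^ m ∸ 2 ^ r) * y)
               (rankCount≡gaussBinom*indepTuples m n (suc r)) (rankCount≡gaussBinom*indepTuples m n r) ⟩
    2 ^ suc r * (gaussBinom n (suc r) * (indepTuples m r * (2 ^ m ∸ 2 ^ r))) + (2 ^ m ∸ 2 ^ r) * (gaussBinom n r * indepTuples m r)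
      ≡⟨ pascal (2 ^ suc r) (gaussBinom n (suc r)) (gaussBinom n r) (indepTuples m r) (2 ^ m ∸ 2 ^ r) ⟩
    gaussBinom (suc n) (suc r) * indepTuples m (suc r) ∎
    where
    open ≡-Reasoning
    scale : ∀ k r → sumMat m n (λ B → 𝟙 (rank n B ≟ r) * k) ≡ k * rankCount m n r
    scale k r = trans (sumMat-cong m n (λ B → *-comm (𝟙 (rank n B ≟ r)) k)) (sumMat-* m n k (λ B → 𝟙 (rank n B ≟ r)))
    pascal : ∀ q g₁ g₀ p d → q * (g₁ * (p * d)) + d * (g₀ * p) ≡ (g₀ + q * g₁) * (p * d)
    pascal = solve-∀

  embed : ∀ {m} → F2Vec m → F2Vec (suc m)
  embed {m} x = does (zeroVec m ≟v x) ∷ x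

  U : (m : ℕ) → Fin (2 ^ m) → F2Vec (suc m)
  U m = embed ∘ bits m

  U-injective : ∀ m → Injective _≡_ _≡_ (U m)
  U-injective m = bits-injective m ∘ cong tail

  U-nonzero : ∀ m i → U m i ≢ zeroVec (suc m)
  U-nonzero m i Ui≡0 =
    contradiction (trans (sym (dec-true (zeroVec m ≟v bits m i) (sym (cong tail Ui≡0)))) (cong head Ui≡0)) λ ()

  kernelCount-U : ∀ {m} (B : Matrix m (suc m)) →
    kernelCount B (U m) ≡ count m (λ x → apply B (embed x) ≟v zeroVec m)
  kernelCount-U {m} B = begin
    kernelCount B (U m)
      ≡⟨ length-filter≡sum-𝟙 (λ i → apply B (U m i) ≟v zeroVec m) (allFin (2 ^ m)) ⟩
    sum (mapˡ (λ i → 𝟙 (apply B (U m i) ≟v zeroVec m)) (allFin (2 ^ m)))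
      ≡⟨ sum-allFin (2 ^ m) _ ⟩
    sumFin (2 ^ m) (λ i → 𝟙 (apply B (U m i) ≟v zeroVec m))
      ≡⟨ sumFin-bits m (λ x → 𝟙 (apply B (embed x) ≟v zeroVec m)) ⟩
    count m (λ x → apply B (embed x) ≟v zeroVec m) ∎
    where open ≡-Reasoning

  kernelSize≤kernelCount-U : ∀ {m} (c : F2Vec m) (B : Matrix m m) → kernelSize B ≤ kernelCount (addCol c B) (U m) + 1
  kernelSize≤kernelCount-U {m} c B = begin
    kernelSize B
      ≤⟨ sumF2-mono m (λ x → pointwise x (zeroVec m ≟v x)) ⟩
    sumF2 m (λ x → 𝟙 (apply (addCol c B) (embed x) ≟v zeroVec m) + 𝟙 (zeroVec m ≟v x))
      ≡⟨ sumF2-+ m _ _ ⟩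
    count m (λ x → apply (addCol c B) (embed x) ≟v zeroVec m) + count m (zeroVec m ≟v_)
      ≡⟨ cong₂ _+_ (kernelCount-U (addCol c B)) (sym (sumF2-𝟙≟ m (zeroVec m))) ⟨
    kernelCount (addCol c B) (U m) + 1 ∎
    where
    open ≤-Reasoning
    pointwise : ∀ x (0≟x : Dec (zeroVec m ≡ x)) →
      𝟙 (apply B x ≟v zeroVec m) ≤ 𝟙 (apply (addCol c B) (does 0≟x ∷ x) ≟v zeroVec m) + 𝟙 0≟x
    pointwise x (yes _) = ≤-trans (𝟙≤1 (apply B x ≟v zeroVec m)) (m≤n+m 1 _)
    pointwise x (no _)  = ≤-trans (≤-reflexive (cong (λ v → 𝟙 (v ≟v zeroVec m)) (sym (apply-addCol-false c B x))))
                                  (m≤m+n _ 0)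

  goodCount-U-lower : ∀ {a L m} → 1 ≤ a → L + a ≡ m →
    2 ^ m * rankCount m m L ≤ goodCount m (suc m) (U m) (2 ^ a ∸ 2)
  goodCount-U-lower {a} {L} {m} 1≤a L+a≡m = begin
    2 ^ m * rankCount m m L
      ≡⟨ sumF2-const m _ ⟨
    sumF2 m (λ _ → sumMat m m (λ B → 𝟙 (rank m B ≟ L)))
      ≤⟨ sumF2-mono m (λ c → sumMat-mono m m (λ B → 𝟙-mono (rank m B ≟ L) (good? (addCol c B)) (rank≡L⇒good c B))) ⟩
    sumF2 m (λ c → sumMat m m (λ B → 𝟙 (good? (addCol c B))))
      ≡⟨ sumMat-addCol m m (𝟙 ∘ good?) ⟨
    sumMat m (suc m) (𝟙 ∘ good?)
      ≡⟨ trans (length-filter≡sum-𝟙 good? (allMatrices m (suc m))) (sum-allMatrices m (suc m) (𝟙 ∘ good?)) ⟨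
    goodCount m (suc m) (U m) (2 ^ a ∸ 2) ∎
    where
    open ≤-Reasoning
    good? : ∀ B → Dec (suc (2 ^ a ∸ 2) ≤ kernelCount B (U m))
    good? B = suc (2 ^ a ∸ 2) ≤? kernelCount B (U m)
    rank≡L⇒good : ∀ c B → rank m B ≡ L → suc (2 ^ a ∸ 2) ≤ kernelCount (addCol c B) (U m)
    rank≡L⇒good c B ρ≡L = +-cancelʳ-≤ 1 _ _ (begin
      suc (2 ^ a ∸ 2) + 1                 ≡⟨ trans (sym (+-suc (2 ^ a ∸ 2) 1)) (m∸n+n≡m (^-monoʳ-≤ 2 1≤a)) ⟩
      2 ^ a                               ≡⟨ kernelSize-of-rank m B (trans (cong (_+ a) ρ≡L) L+a≡m) ⟨
      kernelSize B                        ≤⟨ kernelSize≤kernelCount-U c B ⟩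
      kernelCount (addCol c B) (U m) + 1  ∎)

module Estimates where

  open Counting using (gaussBinom; gaussBinom-zero; indepTuples; rankCount; rankCount≡gaussBinom*indepTuples)
  open import Data.Nat using (ℕ; zero; suc; pred; _+_; _*_; _^_; _∸_; _≤_; NonZero)
  open import Data.Nat.Properties
  open import Data.Nat.Tactic.RingSolver using (solve-∀)
  open import Data.Product using (_,_)
  open import Function using (_∘_)
  open import Relation.Binary.PropositionalEquality using (_≡_; refl; sym; trans; cong; cong₂; subst; module ≡-Reasoning)
  open import Algebra.Properties.CommutativeSemigroup *-commutativeSemigroup using (x∙yz≈y∙xz)

  ∏ : (ℕ → ℕ) → ℕ → ℕ → ℕ
  ∏ f s zero    = 1
  ∏ f s (suc k) = f (suc s) * ∏ f (suc s) k

  ∏-+ : ∀ f s k l → ∏ f s (k + l) ≡ ∏ f s k * ∏ f (s + k) l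
  ∏-+ f s zero    l = sym (trans (+-identityʳ _) (cong (λ s → ∏ f s l) (+-identityʳ s)))
  ∏-+ f s (suc k) l = begin
    f (suc s) * ∏ f (suc s) (k + l)                  ≡⟨ cong (f (suc s) *_) (∏-+ f (suc s) k l) ⟩
    f (suc s) * (∏ f (suc s) k * ∏ f (suc s + k) l)  ≡⟨ *-assoc (f (suc s)) _ _ ⟨
    f (suc s) * ∏ f (suc s) k * ∏ f (suc s + k) l    ≡⟨ cong (λ t → f (suc s) * ∏ f (suc s) k * ∏ f t l) (+-suc s k) ⟨
    f (suc s) * ∏ f (suc s) k * ∏ f (s + suc k) l    ∎
    where open ≡-Reasoning

  ∏-snoc : ∀ f s k → ∏ f s (suc k) ≡ ∏ f s k * f (suc (s + k))
  ∏-snoc f s k = begin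
    ∏ f s (suc k)                    ≡⟨ cong (∏ f s) (+-comm 1 k) ⟩
    ∏ f s (k + 1)                    ≡⟨ ∏-+ f s k 1 ⟩
    ∏ f s k * (f (suc (s + k)) * 1)  ≡⟨ cong (∏ f s k *_) (*-identityʳ _) ⟩
    ∏ f s k * f (suc (s + k))        ∎
    where open ≡-Reasoning

  ∏-mono : ∀ {f g} → (∀ j → f j ≤ g j) → ∀ s k → ∏ f s k ≤ ∏ g s k
  ∏-mono f≤g s zero    = ≤-refl
  ∏-mono f≤g s (suc k) = *-mono-≤ (f≤g (suc s)) (∏-mono f≤g (suc s) k)

  ∏-nonZero : ∀ {f} → (∀ j → NonZero (f (suc j))) → ∀ s k → NonZero (∏ f s k)
  ∏-nonZero f≢0 s zero    = _
  ∏-nonZero f≢0 s (suc k) = m*n≢0 _ _ {{f≢0 s}} {{∏-nonZero f≢0 (suc s) k}}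

  mersenne : ℕ → ℕ
  mersenne j = pred (2 ^ j)

  suc-mersenne : ∀ j → suc (mersenne j) ≡ 2 ^ j
  suc-mersenne j = suc-pred (2 ^ j) {{m^n≢0 2 j}}

  mersenne-suc : ∀ j → mersenne (suc j) ≡ suc (2 * mersenne j)
  mersenne-suc j = trans (cong (λ x → pred (2 * x)) (sym (suc-mersenne j))) (+-suc (mersenne j) (1 * mersenne j))

  mersenne-+ : ∀ i j → mersenne i + 2 ^ i * mersenne j ≡ mersenne (i + j)
  mersenne-+ i j = suc-injective (begin
    suc (mersenne i) + 2 ^ i * mersenne j  ≡⟨ cong (_+ 2 ^ i * mersenne j) (suc-mersenne i) ⟩
    2 ^ i + 2 ^ i * mersenne j             ≡⟨ *-suc (2 ^ i) (mersenne j) ⟨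
    2 ^ i * suc (mersenne j)               ≡⟨ cong (2 ^ i *_) (suc-mersenne j) ⟩
    2 ^ i * 2 ^ j                          ≡⟨ ^-distribˡ-+-* 2 i j ⟨
    2 ^ (i + j)                            ≡⟨ suc-mersenne (i + j) ⟨
    suc (mersenne (i + j))                 ∎)
    where open ≡-Reasoning

  mersenne≤2^ : ∀ j → mersenne j ≤ 2 ^ j
  mersenne≤2^ j = pred[n]≤n

  mersenneProd : ℕ → ℕ → ℕ
  mersenneProd = ∏ mersenne

  pow2Prod : ℕ → ℕ → ℕ
  pow2Prod = ∏ (2 ^_)

  mersenneProd≢0 : ∀ s k → NonZero (mersenneProd s k)
  mersenneProd≢0 = ∏-nonZero (λ j → subst NonZero (sym (mersenne-suc j)) _)

  pow2Prod≢0 : ∀ s k → NonZero (pow2Prod s k)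
  pow2Prod≢0 = ∏-nonZero (λ j → m^n≢0 2 (suc j))

  mersenneProd≤pow2Prod : ∀ s k → mersenneProd s k ≤ pow2Prod s k
  mersenneProd≤pow2Prod = ∏-mono mersenne≤2^

  pow2Prod-shift : ∀ s a k → pow2Prod (s + a) k ≡ 2 ^ (a * k) * pow2Prod s k
  pow2Prod-shift s a zero    = cong (λ e → 2 ^ e * 1) (sym (*-zeroʳ a))
  pow2Prod-shift s a (suc k) = begin
    2 ^ suc (s + a) * pow2Prod (suc s + a) k
      ≡⟨ cong₂ _*_ (^-distribˡ-+-* 2 (suc s) a) (pow2Prod-shift (suc s) a k) ⟩
    2 ^ suc s * 2 ^ a * (2 ^ (a * k) * pow2Prod (suc s) k)
      ≡⟨ regroup (2 ^ suc s) (2 ^ a) (2 ^ (a * k)) (pow2Prod (suc s) k) ⟩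
    2 ^ a * 2 ^ (a * k) * (2 ^ suc s * pow2Prod (suc s) k)
      ≡⟨ cong (_* pow2Prod s (suc k)) (trans (sym (^-distribˡ-+-* 2 a (a * k))) (cong (2 ^_) (sym (*-suc a k)))) ⟩
    2 ^ (a * suc k) * pow2Prod s (suc k) ∎
    where
    open ≡-Reasoning
    regroup : ∀ x p q W → x * p * (q * W) ≡ p * q * (x * W)
    regroup = solve-∀

  gaussBinom-above : ∀ n k → gaussBinom n (suc (n + k)) ≡ 0
  gaussBinom-above zero    k = refl
  gaussBinom-above (suc n) k = begin
    gaussBinom n (suc (n + k)) + 2 ^ suc (suc (n + k)) * gaussBinom n (suc (suc n + k))
      ≡⟨ cong₂ (λ x y → x + 2 ^ suc (suc (n + k)) * y) (gaussBinom-above n k)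
               (trans (cong (λ t → gaussBinom n (suc t)) (sym (+-suc n k))) (gaussBinom-above n (suc k))) ⟩
    0 + 2 ^ suc (suc (n + k)) * 0
      ≡⟨ *-zeroʳ (2 ^ suc (suc (n + k))) ⟩
    0 ∎
    where open ≡-Reasoning

  gaussBinom-diag : ∀ n → gaussBinom n n ≡ 1
  gaussBinom-diag zero    = refl
  gaussBinom-diag (suc n) = begin
    gaussBinom n n + 2 ^ suc n * gaussBinom n (suc n)
      ≡⟨ cong₂ (λ x y → x + 2 ^ suc n * y) (gaussBinom-diag n)
               (trans (cong (λ t → gaussBinom n (suc t)) (sym (+-identityʳ n))) (gaussBinom-above n 0)) ⟩
    1 + 2 ^ suc n * 0
      ≡⟨ cong suc (*-zeroʳ (2 ^ suc n)) ⟩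
    1 ∎
    where open ≡-Reasoning

  gaussBinom-closed : ∀ k a → gaussBinom (k + a) k * mersenneProd 0 k ≡ mersenneProd a k
  gaussBinom-closed zero    a       = cong (_* 1) (gaussBinom-zero a)
  gaussBinom-closed (suc k) zero    =
    trans (cong (λ n → gaussBinom n (suc k) * mersenneProd 0 (suc k)) (+-identityʳ (suc k)))
          (trans (cong (_* mersenneProd 0 (suc k)) (gaussBinom-diag (suc k))) (*-identityˡ _))
  gaussBinom-closed (suc k) (suc a) = begin
    (g₀ + 2 ^ suc k * gaussBinom (k + suc a) (suc k)) * mersenneProd 0 (suc k)
      ≡⟨ cong₂ (λ n M → (g₀ + 2 ^ suc k * gaussBinom n (suc k)) * M) (+-suc k a) (∏-snoc mersenne 0 k) ⟩
    (g₀ + 2 ^ suc k * g₁) * (mersenneProd 0 k * mersenne (suc k))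
      ≡⟨ distribute g₀ g₁ (2 ^ suc k) (mersenneProd 0 k) (mersenne (suc k)) ⟩
    (g₀ * mersenneProd 0 k) * mersenne (suc k) + 2 ^ suc k * (g₁ * (mersenneProd 0 k * mersenne (suc k)))
      ≡⟨ cong₂ _+_ (cong (_* mersenne (suc k)) (gaussBinom-closed k (suc a)))
                   (trans (cong (λ M → 2 ^ suc k * (g₁ * M)) (sym (∏-snoc mersenne 0 k)))
                          (cong (2 ^ suc k *_) (gaussBinom-closed (suc k) a))) ⟩
    mersenneProd (suc a) k * mersenne (suc k) + 2 ^ suc k * (mersenne (suc a) * mersenneProd (suc a) k)
      ≡⟨ factor (mersenneProd (suc a) k) (mersenne (suc k)) (2 ^ suc k) (mersenne (suc a)) ⟩
    mersenneProd (suc a) k * (mersenne (suc k) + 2 ^ suc k * mersenne (suc a))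
      ≡⟨ cong (mersenneProd (suc a) k *_)
              (trans (mersenne-+ (suc k) (suc a)) (cong (mersenne ∘ suc) (trans (+-suc k a) (cong suc (+-comm k a))))) ⟩
    mersenneProd (suc a) k * mersenne (suc (suc a + k))
      ≡⟨ ∏-snoc mersenne (suc a) k ⟨
    mersenneProd (suc a) (suc k) ∎
    where
    open ≡-Reasoning
    g₀ = gaussBinom (k + suc a) k
    g₁ = gaussBinom (suc k + a) (suc k)
    distribute : ∀ g₀ g₁ q M e → (g₀ + q * g₁) * (M * e) ≡ (g₀ * M) * e + q * (g₁ * (M * e))
    distribute = solve-∀
    factor : ∀ P e q e′ → P * e + q * (e′ * P) ≡ P * (e + q * e′)
    factor = solve-∀

  indepTuples-suc : ∀ m r → indepTuples (suc m) (suc r) ≡ mersenne (suc m) * (2 ^ r * indepTuples m r)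
  indepTuples-suc m zero    = trans (*-identityˡ _) (sym (*-identityʳ _))
  indepTuples-suc m (suc r) = begin
    indepTuples (suc m) (suc r) * (2 * 2 ^ m ∸ 2 * 2 ^ r)
      ≡⟨ cong₂ _*_ (indepTuples-suc m r) (sym (*-distribˡ-∸ 2 (2 ^ m) (2 ^ r))) ⟩
    mersenne (suc m) * (2 ^ r * indepTuples m r) * (2 * (2 ^ m ∸ 2 ^ r))
      ≡⟨ regroup (mersenne (suc m)) (2 ^ r) (indepTuples m r) (2 ^ m ∸ 2 ^ r) ⟩
    mersenne (suc m) * (2 * 2 ^ r * (indepTuples m r * (2 ^ m ∸ 2 ^ r))) ∎
    where
    open ≡-Reasoning
    regroup : ∀ e p t d → e * (p * t) * (2 * d) ≡ e * (2 * p * (t * d))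
    regroup = solve-∀

  indepTuples-closed : ∀ L a → indepTuples (L + a) L * pow2Prod a L ≡ 2 ^ ((L + a) * L) * mersenneProd a L
  indepTuples-closed zero    a = cong (λ e → 2 ^ e * 1) (sym (*-zeroʳ a))
  indepTuples-closed (suc L) a = begin
    indepTuples (suc (L + a)) (suc L) * pow2Prod a (suc L)
      ≡⟨ cong₂ _*_ (indepTuples-suc (L + a) L) (∏-snoc (2 ^_) a L) ⟩
    mersenne (suc (L + a)) * (2 ^ L * indepTuples (L + a) L) * (pow2Prod a L * 2 ^ suc (a + L))
      ≡⟨ regroup (mersenne (suc (L + a))) (2 ^ L) (indepTuples (L + a) L) (pow2Prod a L) (2 ^ suc (a + L)) ⟩
    (2 ^ L * 2 ^ suc (a + L)) * (indepTuples (L + a) L * pow2Prod a L) * mersenne (suc (L + a))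
      ≡⟨ cong₂ (λ x y → x * y * mersenne (suc (L + a))) (sym (^-distribˡ-+-* 2 L (suc (a + L)))) (indepTuples-closed L a) ⟩
    2 ^ (L + suc (a + L)) * (2 ^ ((L + a) * L) * mersenneProd a L) * mersenne (suc (L + a))
      ≡⟨ regroup′ (2 ^ (L + suc (a + L))) (2 ^ ((L + a) * L)) (mersenneProd a L) (mersenne (suc (L + a))) ⟩
    (2 ^ ((L + a) * L) * 2 ^ (L + suc (a + L))) * (mersenneProd a L * mersenne (suc (L + a)))
      ≡⟨ cong₂ (λ x y → x * (mersenneProd a L * mersenne (suc y))) (sym (^-distribˡ-+-* 2 ((L + a) * L) _)) (+-comm L a) ⟩
    2 ^ ((L + a) * L + (L + suc (a + L))) * (mersenneProd a L * mersenne (suc (a + L)))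
      ≡⟨ cong₂ (λ e P → 2 ^ e * P) (exponent L a) (sym (∏-snoc mersenne a L)) ⟩
    2 ^ (suc (L + a) * suc L) * mersenneProd a (suc L) ∎
    where
    open ≡-Reasoning
    regroup : ∀ e p t W q → e * (p * t) * (W * q) ≡ (p * q) * (t * W) * e
    regroup = solve-∀
    regroup′ : ∀ x y P e → x * (y * P) * e ≡ (y * x) * (P * e)
    regroup′ = solve-∀
    exponent : ∀ L a → (L + a) * L + (L + suc (a + L)) ≡ suc (L + a) * suc L
    exponent = solve-∀

  rankCount-closed : ∀ L a →
    rankCount (L + a) (L + a) L * mersenneProd 0 L * pow2Prod a L ≡ 2 ^ ((L + a) * L) * (mersenneProd a L * mersenneProd a L)
  rankCount-closed L a = begin
    rankCount (L + a) (L + a) L * mersenneProd 0 L * pow2Prod a L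
      ≡⟨ cong (λ R → R * mersenneProd 0 L * pow2Prod a L) (rankCount≡gaussBinom*indepTuples (L + a) (L + a) L) ⟩
    gaussBinom (L + a) L * indepTuples (L + a) L * mersenneProd 0 L * pow2Prod a L
      ≡⟨ regroup (gaussBinom (L + a) L) (indepTuples (L + a) L) (mersenneProd 0 L) (pow2Prod a L) ⟩
    (gaussBinom (L + a) L * mersenneProd 0 L) * (indepTuples (L + a) L * pow2Prod a L)
      ≡⟨ cong₂ _*_ (gaussBinom-closed L a) (indepTuples-closed L a) ⟩
    mersenneProd a L * (2 ^ ((L + a) * L) * mersenneProd a L)
      ≡⟨ x∙yz≈y∙xz (mersenneProd a L) (2 ^ ((L + a) * L)) (mersenneProd a L) ⟩
    2 ^ ((L + a) * L) * (mersenneProd a L * mersenneProd a L) ∎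
    where
    open ≡-Reasoning
    regroup : ∀ g t M W → g * t * M * W ≡ (g * M) * (t * W)
    regroup = solve-∀

  pow2Prod/mersenneProd-mono : ∀ {N L} → N ≤ L → pow2Prod 0 N * mersenneProd 0 L ≤ pow2Prod 0 L * mersenneProd 0 N
  pow2Prod/mersenneProd-mono {N} {L} N≤L with k , refl ← m≤n⇒∃[o]m+o≡n N≤L = begin
    pow2Prod 0 N * mersenneProd 0 (N + k)
      ≡⟨ cong (pow2Prod 0 N *_) (∏-+ mersenne 0 N k) ⟩
    pow2Prod 0 N * (mersenneProd 0 N * mersenneProd N k)
      ≤⟨ *-monoʳ-≤ (pow2Prod 0 N) (*-monoʳ-≤ (mersenneProd 0 N) (mersenneProd≤pow2Prod N k)) ⟩
    pow2Prod 0 N * (mersenneProd 0 N * pow2Prod N k)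
      ≡⟨ regroup (pow2Prod 0 N) (mersenneProd 0 N) (pow2Prod N k) ⟩
    pow2Prod 0 N * pow2Prod N k * mersenneProd 0 N
      ≡⟨ cong (_* mersenneProd 0 N) (∏-+ (2 ^_) 0 N k) ⟨
    pow2Prod 0 (N + k) * mersenneProd 0 N ∎
    where
    open ≤-Reasoning
    regroup : ∀ W M W′ → W * (M * W′) ≡ W * W′ * M
    regroup = solve-∀

  -- The Weierstrass inequality ∏_{j=a+1}^{a+L} (1 - 2^{-j}) ≥ 1 - 2^{-a}, cleared of denominators.
  mersenne*pow2Prod≤2^*mersenneProd : ∀ a L → mersenne a * pow2Prod a L ≤ 2 ^ a * mersenneProd a L
  mersenne*pow2Prod≤2^*mersenneProd a zero    = *-monoˡ-≤ 1 (mersenne≤2^ a)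
  mersenne*pow2Prod≤2^*mersenneProd a (suc L) = *-cancelˡ-≤ (mersenne (suc a)) {{mersenne-suc≢0}} (begin
    mersenne (suc a) * (e * (2 ^ suc a * W))
      ≡⟨ regroup (mersenne (suc a)) e (2 ^ suc a) W ⟩
    e * 2 ^ suc a * (mersenne (suc a) * W)
      ≤⟨ *-monoʳ-≤ (e * 2 ^ suc a) (mersenne*pow2Prod≤2^*mersenneProd (suc a) L) ⟩
    e * 2 ^ suc a * (2 ^ suc a * Q)
      ≡⟨ cong (λ x → e * (2 * x) * (2 * x * Q)) (suc-mersenne a) ⟨
    e * (2 * suc e) * (2 * suc e * Q)
      ≤⟨ m≤m+n _ (suc e * Q) ⟩
    e * (2 * suc e) * (2 * suc e * Q) + suc e * Q
      ≡⟨ expand e Q ⟩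
    suc (2 * e) * (suc e * (suc (2 * e) * Q))
      ≡⟨ cong₂ (λ x y → y * (x * (y * Q))) (suc-mersenne a) (sym (mersenne-suc a)) ⟩
    mersenne (suc a) * (2 ^ a * (mersenne (suc a) * Q)) ∎)
    where
    open ≤-Reasoning
    e = mersenne a
    W = pow2Prod (suc a) L
    Q = mersenneProd (suc a) L
    mersenne-suc≢0 : NonZero (mersenne (suc a))
    mersenne-suc≢0 = subst NonZero (sym (mersenne-suc a)) _
    regroup : ∀ m e p W → m * (e * (p * W)) ≡ e * p * (m * W)
    regroup = solve-∀
    expand : ∀ e Q → e * (2 * suc e) * (2 * suc e * Q) + suc e * Q ≡ suc (2 * e) * (suc e * (suc (2 * e) * Q))
    expand = solve-∀

  boundNum : ℕ → ℕ → ℕ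
  boundNum a N = pow2Prod 0 N * (mersenne a * mersenne a)

  boundDen : ℕ → ℕ → ℕ
  boundDen a N = mersenneProd 0 N * 2 ^ (a * a) * (2 ^ a * 2 ^ a)

  boundDen≢0 : ∀ a N → NonZero (boundDen a N)
  boundDen≢0 a N =
    m*n≢0 _ _ {{m*n≢0 _ _ {{mersenneProd≢0 0 N}} {{m^n≢0 2 (a * a)}}}} {{m*n≢0 _ _ {{m^n≢0 2 a}} {{m^n≢0 2 a}}}}

  2^square-split : ∀ L a → 2 ^ ((L + a) * (L + a)) ≡ 2 ^ (a * a) * 2 ^ ((L + a) * L) * 2 ^ (a * L)
  2^square-split L a = begin
    2 ^ ((L + a) * (L + a))                        ≡⟨ cong (2 ^_) (exponent L a) ⟩
    2 ^ (a * a + (L + a) * L + a * L)              ≡⟨ ^-distribˡ-+-* 2 (a * a + (L + a) * L) (a * L) ⟩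
    2 ^ (a * a + (L + a) * L) * 2 ^ (a * L)        ≡⟨ cong (_* 2 ^ (a * L)) (^-distribˡ-+-* 2 (a * a) ((L + a) * L)) ⟩
    2 ^ (a * a) * 2 ^ ((L + a) * L) * 2 ^ (a * L)  ∎
    where
    open ≡-Reasoning
    exponent : ∀ L a → (L + a) * (L + a) ≡ a * a + (L + a) * L + a * L
    exponent = solve-∀

  -- Multiplying by Q₀L * Wa lets rankCount-closed turn the right-hand side into 2^{mL} Qa².
  rankCount-lower : ∀ {N L} a → N ≤ L →
    boundNum a N * 2 ^ ((L + a) * (L + a)) ≤ rankCount (L + a) (L + a) L * boundDen a N
  rankCount-lower {N} {L} a N≤L = *-cancelʳ-≤ _ _ (Q₀L * Wa) {{Q₀L*Wa≢0}} (begin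
    W₀N * (E * E) * 2 ^ (m * m) * (Q₀L * Wa)
      ≡⟨ r₁ W₀N E (2 ^ (m * m)) Q₀L Wa ⟩
    W₀N * Q₀L * (E * E * 2 ^ (m * m) * Wa)
      ≤⟨ *-monoˡ-≤ (E * E * 2 ^ (m * m) * Wa) (pow2Prod/mersenneProd-mono N≤L) ⟩
    W₀L * Q₀N * (E * E * 2 ^ (m * m) * Wa)
      ≡⟨ cong (λ x → W₀L * Q₀N * (E * E * x * Wa)) (2^square-split L a) ⟩
    W₀L * Q₀N * (E * E * (2 ^ (a * a) * 2 ^ (m * L) * 2 ^ (a * L)) * Wa)
      ≡⟨ r₂ W₀L Q₀N E (2 ^ (a * a)) (2 ^ (m * L)) (2 ^ (a * L)) Wa ⟩
    Q₀N * 2 ^ (a * a) * 2 ^ (m * L) * ((E * Wa) * (E * (2 ^ (a * L) * W₀L)))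
      ≡⟨ cong (λ x → Q₀N * 2 ^ (a * a) * 2 ^ (m * L) * ((E * Wa) * (E * x))) (pow2Prod-shift 0 a L) ⟨
    Q₀N * 2 ^ (a * a) * 2 ^ (m * L) * ((E * Wa) * (E * Wa))
      ≤⟨ *-monoʳ-≤ (Q₀N * 2 ^ (a * a) * 2 ^ (m * L)) (*-mono-≤ weierstrass weierstrass) ⟩
    Q₀N * 2 ^ (a * a) * 2 ^ (m * L) * ((A * Qa) * (A * Qa))
      ≡⟨ r₃ Q₀N (2 ^ (a * a)) (2 ^ (m * L)) A Qa ⟩
    Q₀N * 2 ^ (a * a) * (A * A) * (2 ^ (m * L) * (Qa * Qa))
      ≡⟨ cong (Q₀N * 2 ^ (a * a) * (A * A) *_) (rankCount-closed L a) ⟨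
    Q₀N * 2 ^ (a * a) * (A * A) * (R * Q₀L * Wa)
      ≡⟨ r₄ (Q₀N * 2 ^ (a * a) * (A * A)) R Q₀L Wa ⟩
    R * (Q₀N * 2 ^ (a * a) * (A * A)) * (Q₀L * Wa) ∎)
    where
    open ≤-Reasoning
    m = L + a
    E = mersenne a
    A = 2 ^ a
    R = rankCount m m L
    W₀N = pow2Prod 0 N
    Q₀N = mersenneProd 0 N
    W₀L = pow2Prod 0 L
    Q₀L = mersenneProd 0 L
    Wa = pow2Prod a L
    Qa = mersenneProd a L
    Q₀L*Wa≢0 : NonZero (Q₀L * Wa)
    Q₀L*Wa≢0 = m*n≢0 Q₀L Wa {{mersenneProd≢0 0 L}} {{pow2Prod≢0 a L}}
    weierstrass : E * Wa ≤ A * Qa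
    weierstrass = mersenne*pow2Prod≤2^*mersenneProd a L
    r₁ : ∀ W E p Q V → W * (E * E) * p * (Q * V) ≡ W * Q * (E * E * p * V)
    r₁ = solve-∀
    r₂ : ∀ W Q E x y z V → W * Q * (E * E * (x * y * z) * V) ≡ Q * x * y * ((E * V) * (E * (z * W)))
    r₂ = solve-∀
    r₃ : ∀ Q x y A P → Q * x * y * ((A * P) * (A * P)) ≡ Q * x * (A * A) * (y * (P * P))
    r₃ = solve-∀
    r₄ : ∀ C R Q V → C * (R * Q * V) ≡ R * C * (Q * V)
    r₄ = solve-∀

open Counting using (U; U-injective; U-nonzero; goodCount-U-lower; rankCount)
open Estimates
  using (∏-snoc; mersenne; suc-mersenne; mersenne-suc; mersenneProd; mersenneProd≢0; pow2Prod;
         boundNum; boundDen; boundDen≢0; rankCount-lower)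
open import Data.Fin using (Fin)
open import Data.Integer using (+_)
import Data.Integer as ℤ
import Data.Integer.Properties as ℤ
open import Data.Nat using (ℕ; zero; suc; NonZero; _≥_; _^_; _∸_)
import Data.Nat as ℕ
import Data.Nat.Properties as ℕ
open import Algebra.Properties.CommutativeSemigroup ℕ.*-commutativeSemigroup using (x∙yz≈y∙xz)
open import Data.Product using (Σ; _×_; _,_; ∃-syntax)
open import Data.Rational using (ℚ; _/_; _*_; -_; _-_; _≤_; toℚᵘ; 1ℚ; Positive)
open import Data.Rational.Properties
  using (toℚᵘ-injective; toℚᵘ-fromℚᵘ; toℚᵘ-homo-*; toℚᵘ-homo-+; toℚᵘ-homo‿-; toℚᵘ-cancel-≤; /-cong;
         ≤-trans; ≤-reflexive; <⇒≤; +-monoʳ-≤; +-identityʳ; neg-antimono-≤; positive⁻¹)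
open import Data.Rational.Unnormalised using (mkℚᵘ; _≃_; *≤*; *≡*)
import Data.Rational.Unnormalised as ℚᵘ
import Data.Rational.Unnormalised.Properties as ℚᵘ
open import Function.Definitions using (Injective)
open import Relation.Binary.PropositionalEquality using (_≡_; refl; sym; trans; cong; cong₂; subst; subst₂; module ≡-Reasoning)
open import Relation.Nullary using (¬_)

toℚᵘ-/ : ∀ i n .{{_ : NonZero n}} → toℚᵘ (i / n) ≃ i ℚᵘ./ n
toℚᵘ-/ i (suc n) = toℚᵘ-fromℚᵘ (mkℚᵘ i n)

/-*-/ : ∀ p q r s .{{_ : NonZero q}} .{{_ : NonZero s}} →
  (+ p / q) * (+ r / s) ≡ (+ (p ℕ.* r) / (q ℕ.* s)) {{ℕ.m*n≢0 q s}}
/-*-/ p q@(suc _) r s@(suc _) = toℚᵘ-injective (ℚᵘ.≃-trans (toℚᵘ-homo-* (+ p / q) (+ r / s))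
  (ℚᵘ.≃-trans (ℚᵘ.*-cong (toℚᵘ-/ (+ p) q) (toℚᵘ-/ (+ r) s))
  (ℚᵘ.≃-trans (ℚᵘ.≃-reflexive (cong (ℚᵘ._/ (q ℕ.* s)) (sym (ℤ.pos-* p r))))
              (ℚᵘ.≃-sym (toℚᵘ-/ (+ (p ℕ.* r)) (q ℕ.* s))))))

*≤*⇒/≤/ : ∀ p q r s .{{_ : NonZero q}} .{{_ : NonZero s}} → p ℕ.* s ℕ.≤ r ℕ.* q → + p / q ≤ + r / s
*≤*⇒/≤/ p q@(suc _) r s@(suc _) ps≤rq = toℚᵘ-cancel-≤
  (ℚᵘ.≤-respˡ-≃ (ℚᵘ.≃-sym (toℚᵘ-/ (+ p) q)) (ℚᵘ.≤-respʳ-≃ (ℚᵘ.≃-sym (toℚᵘ-/ (+ r) s))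
    (*≤* (subst₂ ℤ._≤_ (ℤ.pos-* p s) (ℤ.pos-* r q) (ℤ.+≤+ ps≤rq)))))

1-1/q≡pred[q]/q : ∀ q .{{_ : NonZero q}} → 1ℚ - + 1 / q ≡ + ℕ.pred q / q
1-1/q≡pred[q]/q q@(suc q-1) = toℚᵘ-injective (ℚᵘ.≃-trans (toℚᵘ-homo-+ 1ℚ (- (+ 1 / q)))
  (ℚᵘ.≃-trans (ℚᵘ.+-cong (toℚᵘ-/ (+ 1) 1)
                         (ℚᵘ.≃-trans (toℚᵘ-homo‿- (+ 1 / q)) (ℚᵘ.-‿cong (toℚᵘ-/ (+ 1) q))))
  (ℚᵘ.≃-trans (*≡* (cong₂ (λ x y → + x ℤ.* + y) (ℕ.+-identityʳ q-1) (sym (ℕ.*-identityˡ q))))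
              (ℚᵘ.≃-sym (toℚᵘ-/ (+ q-1) q)))))

p-q≤p : ∀ p q → Positive q → p - q ≤ p
p-q≤p p q q>0 = ≤-trans (+-monoʳ-≤ p (neg-antimono-≤ (<⇒≤ (positive⁻¹ q {{q>0}})))) (≤-reflexive (+-identityʳ p))

suc[2^[1+N]∸2]≡mersenne : ∀ N → suc (2 ^ suc N ∸ 2) ≡ mersenne (suc N)
suc[2^[1+N]∸2]≡mersenne N =
  trans (cong (λ x → suc (x ∸ 2)) (trans (sym (suc-mersenne (suc N))) (cong suc (mersenne-suc N)))) (sym (mersenne-suc N))

invγ≡ : ∀ N → invγ N ≡ (+ pow2Prod 0 N / mersenneProd 0 N) {{mersenneProd≢0 0 N}}
invγ≡ zero    = refl
invγ≡ (suc N) = begin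
  invγ N * (+ 2 ^ suc N / d)
    ≡⟨ cong (_* (+ 2 ^ suc N / d)) (invγ≡ N) ⟩
  (+ pow2Prod 0 N / mersenneProd 0 N) * (+ 2 ^ suc N / d)
    ≡⟨ /-*-/ (pow2Prod 0 N) (mersenneProd 0 N) (2 ^ suc N) d ⟩
  (+ (pow2Prod 0 N ℕ.* 2 ^ suc N) / (mersenneProd 0 N ℕ.* d)) {{ℕ.m*n≢0 (mersenneProd 0 N) d}}
    ≡⟨ /-cong {{ℕ.m*n≢0 (mersenneProd 0 N) d}} (cong +_ (sym (∏-snoc (2 ^_) 0 N)))
              (trans (cong (mersenneProd 0 N ℕ.*_) (suc[2^[1+N]∸2]≡mersenne N)) (sym (∏-snoc mersenne 0 N))) ⟩
  + pow2Prod 0 (suc N) / mersenneProd 0 (suc N) ∎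
  where
  open ≡-Reasoning
  d = suc (2 ^ suc N ∸ 2)
  instance
    _ = mersenneProd≢0 0 N
    _ = mersenneProd≢0 0 (suc N)

bound≡ : ∀ a N → bound a N ≡ (+ boundNum a N / boundDen a N) {{boundDen≢0 a N}}
bound≡ a N = begin
  invγ N * pow2inv (a ℕ.* a) * ((1ℚ - pow2inv a) * (1ℚ - pow2inv a))
    ≡⟨ cong₂ (λ x y → x * pow2inv (a ℕ.* a) * (y * y)) (invγ≡ N) (1-1/q≡pred[q]/q (2 ^ a)) ⟩
  (+ W / Q) * (+ 1 / 2 ^ (a ℕ.* a)) * ((+ E / 2 ^ a) * (+ E / 2 ^ a))
    ≡⟨ cong₂ _*_ (/-*-/ W Q 1 (2 ^ (a ℕ.* a))) (/-*-/ E (2 ^ a) E (2 ^ a)) ⟩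
  (+ (W ℕ.* 1) / (Q ℕ.* 2 ^ (a ℕ.* a))) * (+ (E ℕ.* E) / (2 ^ a ℕ.* 2 ^ a))
    ≡⟨ /-*-/ (W ℕ.* 1) (Q ℕ.* 2 ^ (a ℕ.* a)) (E ℕ.* E) (2 ^ a ℕ.* 2 ^ a) ⟩
  + (W ℕ.* 1 ℕ.* (E ℕ.* E)) / boundDen a N
    ≡⟨ /-cong (cong (λ x → + (x ℕ.* (E ℕ.* E))) (ℕ.*-identityʳ W)) refl ⟩
  + boundNum a N / boundDen a N ∎
  where
  open ≡-Reasoning
  W = pow2Prod 0 N
  Q = mersenneProd 0 N
  E = mersenne a
  instance
    _ = mersenneProd≢0 0 N
    _ = ℕ.m^n≢0 2 a
    _ = ℕ.m^n≢0 2 (a ℕ.* a)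
    _ = ℕ.m*n≢0 Q (2 ^ (a ℕ.* a))
    _ = ℕ.m*n≢0 (2 ^ a) (2 ^ a)
    _ = boundDen≢0 a N

bound≤prob : ∀ {a N L} → 1 ℕ.≤ a → N ℕ.≤ L →
  let m = L ℕ.+ a in bound a N ≤ prob m (suc m) (U m) (2 ^ a ∸ 2)
bound≤prob {a} {N} {L} 1≤a N≤L = ≤-trans (≤-reflexive (bound≡ a N))
  (*≤*⇒/≤/ (boundNum a N) (boundDen a N) G (2 ^ (m ℕ.* suc m)) {{boundDen≢0 a N}} {{ℕ.m^n≢0 2 (m ℕ.* suc m)}} (begin
    boundNum a N ℕ.* 2 ^ (m ℕ.* suc m)            ≡⟨ cong (λ e → boundNum a N ℕ.* 2 ^ e) (ℕ.*-suc m m) ⟩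
    boundNum a N ℕ.* 2 ^ (m ℕ.+ m ℕ.* m)          ≡⟨ cong (boundNum a N ℕ.*_) (ℕ.^-distribˡ-+-* 2 m (m ℕ.* m)) ⟩
    boundNum a N ℕ.* (2 ^ m ℕ.* 2 ^ (m ℕ.* m))    ≡⟨ x∙yz≈y∙xz (boundNum a N) (2 ^ m) _ ⟩
    2 ^ m ℕ.* (boundNum a N ℕ.* 2 ^ (m ℕ.* m))    ≤⟨ ℕ.*-monoʳ-≤ (2 ^ m) (rankCount-lower a N≤L) ⟩
    2 ^ m ℕ.* (rankCount m m L ℕ.* boundDen a N)  ≡⟨ ℕ.*-assoc (2 ^ m) _ _ ⟨
    2 ^ m ℕ.* rankCount m m L ℕ.* boundDen a N    ≤⟨ ℕ.*-monoˡ-≤ (boundDen a N) (goodCount-U-lower {L = L} 1≤a refl) ⟩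
    G ℕ.* boundDen a N                            ∎))
  where
  open ℕ.≤-Reasoning
  m = L ℕ.+ a
  G = goodCount m (suc m) (U m) (2 ^ a ∸ 2)

bound≤prob-eventually : ∀ {a N m} → 1 ℕ.≤ a → m ≥ N ℕ.+ a → bound a N ≤ prob m (suc m) (U m) (2 ^ a ∸ 2)
bound≤prob-eventually {a} {N} {m} 1≤a m≥N+a =
  subst (λ m → bound a N ≤ prob m (suc m) (U m) (2 ^ a ∸ 2)) (ℕ.m∸n+n≡m a≤m) (bound≤prob 1≤a N≤m∸a)
  where
  a≤m : a ℕ.≤ m
  a≤m = ℕ.≤-trans (ℕ.m≤n+m a N) m≥N+a
  N≤m∸a : N ℕ.≤ m ∸ a
  N≤m∸a = ℕ.≤-trans (ℕ.≤-reflexive (sym (ℕ.m+n∸n≡m N a))) (ℕ.∸-monoˡ-≤ a m≥N+a)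

proposition2p4 : (a : ℕ) → a ≥ 1 →
    Σ (ℕ → ℕ) λ n →
    Σ ((m : ℕ) → Fin (2 ^ m) → F2Vec (n m)) λ U →
      ((m : ℕ) → Injective _≡_ _≡_ (U m)) ×
      ((m : ℕ) (i : Fin (2 ^ m)) → ¬ (U m i ≡ zeroVec (n m))) ×
      ((N : ℕ) (ε : ℚ) → Positive ε →
        ∃[ M ] ((m : ℕ) → m ≥ M →
          bound a N - ε ≤ prob m (n m) (U m) (2 ^ a ∸ 2)))
proposition2p4 a a≥1 =
  suc , U , U-injective , U-nonzero ,
  λ N ε ε>0 → N ℕ.+ a , λ m m≥N+a → ≤-trans (p-q≤p (bound a N) ε ε>0) (bound≤prob-eventually a≥1 m≥N+a)
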